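{- Let $U_n$ be the universal Coxeter group of rank $n$, and let $*$ be an involutive automorphism of $U_n$ preserving its simple generating set and fixing exactly $f$ simple generators. Then \[L_{U_n,*}(q)=\frac{1+q^2}{1+q}\cdot\frac{1-(f-1)q}{1-(n-1)q^2},\qquad P_{U_n}(q)=\frac{1+q}{1-(n-1)q},\qquad F_{U_n,*}(q)=\frac{1+q}{1-(f-1)q}.\]
   Context: The universal Coxeter group $U_n$ of rank $n$ is the Coxeter group on $n$ simple generators $S$ with no braid relations (the product of any two distinct simple generators has infinite order); $\ell$ is its length function. $P_{W}(q)=\sum_{w\in W}q^{\ell(w)}$ and $F_{W,*}(q)=\sum_{w\in W,\,w^*=w}q^{\ell(w)}$. $\mathbf I_*(W)=\{w:w^{ -1}=w^*\}$, and $\ell'_*:\mathbf I_*(W)\to\mathbb N$ is the unique function with $\ell'_*(1)=0$, $\ell'_*(sws^*)=\ell'_*(w)$ for $s\in S$, and $\ell'_*(ws)-\ell'_*(w)=\ell(ws)-\ell(w)$ whenever $s\in S$ and $w,ws\in\mathbf I_*(W)$. $L_{W,*}(q)=\sum_{w\in\mathbf I_*(W)}q^{\ell(w)}\left(\frac{q-1}{q+1}\right)^{\ell'_*(w)}$. -}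

module Defs where

open import Data.Nat as ℕ using (ℕ; zero; suc; _∸_)
open import Data.Integer as ℤ using (ℤ; +_; -_; -[1+_])
open import Data.Fin using (Fin)
open import Data.Fin.Properties using () renaming (_≟_ to _≟ᶠ_)
open import Data.List using (List; []; _∷_; map; concatMap; allFin; upTo; length; filter; reverse; foldr)
open import Data.List.Properties using (≡-dec)
open import Data.Bool using (Bool; true; false; if_then_else_; _∧_)
open import Data.Product using (_×_; _,_)
open import Data.Unit using (⊤; tt)
open import Relation.Nullary using (Dec; yes; no; ¬_; does)
open import Relation.Nullary.Decidable using (_×-dec_; ¬?)
open import Relation.Binary.PropositionalEquality using (_≡_; _≢_)

-- Formal power series over ℤ in one variable q: coefficient sequences.

PS : Set
PS = ℕ → ℤ

_≗ₚ_ : PS → PS → Set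
a ≗ₚ b = ∀ k → a k ≡ b k

infix 4 _≗ₚ_

sumℤ : List ℤ → ℤ
sumℤ = foldr ℤ._+_ (+ 0)

_⊛_ : PS → PS → PS
(a ⊛ b) k = sumℤ (map (λ i → a i ℤ.* b (k ∸ i)) (upTo (suc k)))

infixl 7 _⊛_

poly : List ℤ → PS
poly []       k       = + 0
poly (c ∷ cs) zero    = c
poly (c ∷ cs) (suc k) = poly cs k

oneS : PS
oneS = poly (+ 1 ∷ [])

_^ₚ_ : PS → ℕ → PS
g ^ₚ zero  = oneS
g ^ₚ suc m = g ⊛ (g ^ₚ m)

alt : ℕ → ℤ
alt zero    = + 1
alt (suc k) = - alt k

inv1+q : PS
inv1+q = alt

qm1/qp1 : PS
qm1/qp1 = poly (- (+ 1) ∷ + 1 ∷ []) ⊛ inv1+q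

-- The universal Coxeter group U_n, realised by its normal forms:
-- reduced words over S = Fin n (no two adjacent letters equal).
-- Length ℓ = word length.

Word : ℕ → Set
Word n = List (Fin n)

Reduced : ∀ {n} → Word n → Set
Reduced []           = ⊤
Reduced (x ∷ [])     = ⊤
Reduced (x ∷ y ∷ w)  = (x ≢ y) × Reduced (y ∷ w)

reduced? : ∀ {n} (w : Word n) → Dec (Reduced w)
reduced? []          = yes tt
reduced? (x ∷ [])    = yes tt
reduced? (x ∷ y ∷ w) = ¬? (x ≟ᶠ y) ×-dec reduced? (y ∷ w)

ℓ : ∀ {n} → Word n → ℕ
ℓ = length

_·ʳ_ : ∀ {n} → Word n → Fin n → Word n
[]          ·ʳ s = s ∷ []
(x ∷ [])    ·ʳ s with x ≟ᶠ s
... | yes _ = []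
... | no  _ = x ∷ s ∷ []
(x ∷ y ∷ w) ·ʳ s = x ∷ ((y ∷ w) ·ʳ s)

_·ˡ_ : ∀ {n} → Fin n → Word n → Word n
s ·ˡ []      = s ∷ []
s ·ˡ (x ∷ w) with s ≟ᶠ x
... | yes _ = w
... | no  _ = s ∷ x ∷ w

inv : ∀ {n} → Word n → Word n
inv = reverse

-- the automorphism of U_n induced by a permutation σ of S
star : ∀ {n} → (Fin n → Fin n) → Word n → Word n
star σ = map σ

Twisted : ∀ {n} → (Fin n → Fin n) → Word n → Set
Twisted σ w = inv w ≡ star σ w

twisted? : ∀ {n} (σ : Fin n → Fin n) (w : Word n) → Dec (Twisted σ w)
twisted? σ w = ≡-dec _≟ᶠ_ (inv w) (star σ w)

fixedCount : ∀ {n} → (Fin n → Fin n) → ℕ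
fixedCount {n} σ = length (filter (λ i → σ i ≟ᶠ i) (allFin n))

wordsOfLength : ∀ n → ℕ → List (Word n)
wordsOfLength n zero    = [] ∷ []
wordsOfLength n (suc k) = concatMap (λ i → map (i ∷_) (wordsOfLength n k)) (allFin n)

indicator : ∀ {P : Set} → Dec P → ℤ → ℤ
indicator d z = if does d then z else + 0

Pser : ℕ → PS
Pser n k = sumℤ (map (λ w → indicator (reduced? w) (+ 1)) (wordsOfLength n k))

Fser : ∀ {n} → (Fin n → Fin n) → PS
Fser {n} σ k =
  sumℤ (map (λ w → indicator (reduced? w ×-dec ≡-dec _≟ᶠ_ (star σ w) w) (+ 1))
            (wordsOfLength n k))

-- L_{U_n,*}(q) = Σ_{w ∈ I_*} q^{ℓ(w)} ((q-1)/(q+1))^{ℓ'(w)}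
-- coefficient of q^k: sum over j ≤ k and w ∈ I_* with ℓ(w) = j of the
-- coefficient of q^{k-j} in ((q-1)/(q+1))^{ℓ'(w)}.
Lser : ∀ {n} → (Fin n → Fin n) → (Word n → ℕ) → PS
Lser {n} σ ℓ' k =
  sumℤ (map (λ j → sumℤ (map (λ w → indicator (reduced? w ×-dec twisted? σ w)
                                          ((qm1/qp1 ^ₚ ℓ' w) (k ∸ j)))
                              (wordsOfLength n j)))
            (upTo (suc k)))

-- ℓ'_* : the defining properties (imposed on twisted involutions only)
IsLengthPrime : ∀ {n} → (Fin n → Fin n) → (Word n → ℕ) → Set
IsLengthPrime {n} σ ℓ' =
    (ℓ' [] ≡ 0)
  × (∀ (w : Word n) (s : Fin n) → Reduced w → Twisted σ w →
       ℓ' (s ·ˡ (w ·ʳ σ s)) ≡ ℓ' w)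
  × (∀ (w : Word n) (s : Fin n) → Reduced w → Twisted σ w → Twisted σ (w ·ʳ s) →
       (+ ℓ' (w ·ʳ s)) ℤ.- (+ ℓ' w) ≡ (+ ℓ (w ·ʳ s)) ℤ.- (+ ℓ w))

{-# OPTIONS --safe #-}
module Submission where

-- Reduced words over an alphabet of m letters satisfy c₀ = 1, c₁ = m and c_{k+2} = (m − 1) c_{k+1},
-- since a reduced word may be prefixed by any letter except its first one.  This gives P (all n
-- generators) and F (a word is *-fixed iff all its letters are, so f letters).  A reduced twisted
-- involution of length k + 2 is i u σ(i) with u a reduced twisted involution not starting with i;
-- hence the counts T_k satisfy T₀ = 1, T₁ = f, T₂ = n − f, T_{k+3} = (n − 1) T_{k+1}, and the
-- defining properties of ℓ'_* force ℓ'_*(w) = ℓ(w) mod 2.  So L = Σ_k T_k q^k R^{k mod 2} with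
-- R = (q − 1)/(q + 1); as (1 + q) R^{k mod 2} = (−1)^k + q, the series (1 + q) L has coefficients
-- (−1)^k T_k + T_{k−1}, which obey the same recursion, and (1 − (n − 1) q²)(1 + q) L is a polynomial.

open import Defs
open import Data.Nat as ℕ using (ℕ; zero; suc; _∸_; _%_; _≤_; s≤s)
import Data.Nat.Properties as ℕ
open import Data.Integer using (ℤ; +_; -_; _+_; _-_; _*_)
import Data.Integer.Properties as ℤ
open import Data.Integer.Tactic.RingSolver using (solve-∀)
open import Algebra.Properties.Semiring.Sum ℤ.+-*-semiring
  using (sum-syntax; sum-cong-≗; sum-replicate-zero; ∑-comm; *-distribˡ-sum; *-distribʳ-sum)
open import Data.Fin using (Fin; zero; suc)
open import Data.Fin.Properties using (_≟_)
open import Data.List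
  using ( List; []; _∷_; _++_; _∷ʳ_; map; reverse; length; filter; concatMap; allFin; tabulate
        ; upTo; applyUpTo; initLast; _∷ʳ′_)
import Data.List.Properties as List
open import Data.List.Relation.Unary.All using (All; []; _∷_; all?; universal-U)
open import Data.Product using (_×_; _,_; proj₁; proj₂)
open import Data.Unit using (tt)
open import Function using (_∘_; id)
open import Relation.Binary.PropositionalEquality
open import Relation.Nullary using (Dec; yes; no; contradiction)
open import Relation.Nullary.Decidable using (_×-dec_; ¬?)
open import Relation.Unary using (Decidable)
open import Relation.Unary.Properties using (U?)

open ≡-Reasoning

-- Power series

-- ∑qʲ g is the series Σⱼ qʲ gⱼ(q).
∑qʲ : (ℕ → PS) → PS
∑qʲ g k = sumℤ (map (λ j → g j (k ∸ j)) (upTo (suc k)))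

∑qʲ-zero : ∀ g → ∑qʲ g 0 ≡ g 0 0
∑qʲ-zero g = ℤ.+-identityʳ (g 0 0)

∑qʲ-suc : ∀ g k → ∑qʲ g (suc k) ≡ g 0 (suc k) + ∑qʲ (g ∘ suc) k
∑qʲ-suc g k = cong (_+_ (g 0 (suc k))) (cong sumℤ (begin
  map (λ j → g j (suc k ∸ j)) (applyUpTo suc (suc k))  ≡⟨ List.map-applyUpTo suc _ (suc k) ⟩
  applyUpTo (λ j → g (suc j) (k ∸ j)) (suc k)          ≡⟨ List.map-applyUpTo id _ (suc k) ⟨
  map (λ j → g (suc j) (k ∸ j)) (upTo (suc k))          ∎))

∑qʲ-cong : ∀ {g h : ℕ → PS} → (∀ j m → g j m ≡ h j m) → ∑qʲ g ≗ₚ ∑qʲ h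
∑qʲ-cong eq k = cong sumℤ (List.map-cong (λ j → eq j (k ∸ j)) (upTo (suc k)))

-- Coefficient k + 1 of (1 + q) · ∑qʲ g when every (1 + q) · gⱼ is a polynomial of degree ≤ 1.
∑qʲ-telescope : ∀ (g : ℕ → PS) → (∀ j m → g j (2 ℕ.+ m) + g j (1 ℕ.+ m) ≡ + 0) →
                ∀ k → ∑qʲ g (suc k) + ∑qʲ g k ≡ g (suc k) 0 + (g k 1 + g k 0)
∑qʲ-telescope g tail zero = begin
  ∑qʲ g 1 + ∑qʲ g 0                   ≡⟨ cong₂ _+_ (∑qʲ-suc g 0) (∑qʲ-zero g) ⟩
  (g 0 1 + ∑qʲ (g ∘ suc) 0) + g 0 0   ≡⟨ cong (λ x → (g 0 1 + x) + g 0 0) (∑qʲ-zero (g ∘ suc)) ⟩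
  (g 0 1 + g 1 0) + g 0 0             ≡⟨ rotate (g 0 1) (g 1 0) (g 0 0) ⟩
  g 1 0 + (g 0 1 + g 0 0)             ∎
  where
  rotate : ∀ a b c → (a + b) + c ≡ b + (a + c)
  rotate = solve-∀
∑qʲ-telescope g tail (suc k) = begin
  ∑qʲ g (2 ℕ.+ k) + ∑qʲ g (1 ℕ.+ k)
    ≡⟨ cong₂ _+_ (∑qʲ-suc g (suc k)) (∑qʲ-suc g k) ⟩
  (g 0 (2 ℕ.+ k) + ∑qʲ g′ (1 ℕ.+ k)) + (g 0 (1 ℕ.+ k) + ∑qʲ g′ k)
    ≡⟨ interchange (g 0 (2 ℕ.+ k)) (∑qʲ g′ (1 ℕ.+ k)) (g 0 (1 ℕ.+ k)) (∑qʲ g′ k) ⟩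
  (g 0 (2 ℕ.+ k) + g 0 (1 ℕ.+ k)) + (∑qʲ g′ (1 ℕ.+ k) + ∑qʲ g′ k)
    ≡⟨ cong₂ _+_ (tail 0 k) (∑qʲ-telescope g′ (tail ∘ suc) k) ⟩
  + 0 + (g (2 ℕ.+ k) 0 + (g (1 ℕ.+ k) 1 + g (1 ℕ.+ k) 0))
    ≡⟨ ℤ.+-identityˡ _ ⟩
  g (2 ℕ.+ k) 0 + (g (1 ℕ.+ k) 1 + g (1 ℕ.+ k) 0)
    ∎
  where
  g′ = g ∘ suc
  interchange : ∀ a b c d → (a + b) + (c + d) ≡ (a + c) + (b + d)
  interchange = solve-∀

⊛-zero : ∀ a b → (a ⊛ b) 0 ≡ a 0 * b 0
⊛-zero a b = ∑qʲ-zero (λ i m → a i * b m)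

⊛-suc : ∀ a b k → (a ⊛ b) (suc k) ≡ a 0 * b (suc k) + ((a ∘ suc) ⊛ b) k
⊛-suc a b = ∑qʲ-suc (λ i m → a i * b m)

⊛-congˡ : ∀ {a a′} b → a ≗ₚ a′ → a ⊛ b ≗ₚ a′ ⊛ b
⊛-congˡ b eq = ∑qʲ-cong (λ i m → cong (_* b m) (eq i))

⊛-identityʳ : ∀ a → a ⊛ oneS ≗ₚ a
⊛-identityʳ a zero    = trans (⊛-zero a oneS) (ℤ.*-identityʳ (a 0))
⊛-identityʳ a (suc k) = begin
  (a ⊛ oneS) (suc k)                 ≡⟨ ⊛-suc a oneS k ⟩
  a 0 * + 0 + ((a ∘ suc) ⊛ oneS) k   ≡⟨ cong₂ _+_ (ℤ.*-zeroʳ (a 0)) (⊛-identityʳ (a ∘ suc) k) ⟩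
  + 0 + a (suc k)                    ≡⟨ ℤ.+-identityˡ _ ⟩
  a (suc k)                          ∎

poly-[]-⊛ : ∀ s k → (poly [] ⊛ s) k ≡ + 0
poly-[]-⊛ s zero    = ⊛-zero (poly []) s
poly-[]-⊛ s (suc k) = trans (⊛-suc (poly []) s k) (trans (ℤ.+-identityˡ _) (poly-[]-⊛ s k))

-- The coefficients of poly cs ⊛ s, by recursion on cs so that they unfold definitionally.
_⊙_ : List ℤ → PS → PS
([] ⊙ s) k                  = + 0
((c ∷ []) ⊙ s) k            = c * s k
((c ∷ c′ ∷ cs) ⊙ s) zero    = c * s 0
((c ∷ c′ ∷ cs) ⊙ s) (suc k) = c * s (suc k) + ((c′ ∷ cs) ⊙ s) k

poly-⊛ : ∀ cs s → poly cs ⊛ s ≗ₚ cs ⊙ s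
poly-⊛ []            s k       = poly-[]-⊛ s k
poly-⊛ (c ∷ [])      s zero    = ⊛-zero (poly (c ∷ [])) s
poly-⊛ (c ∷ [])      s (suc k) = begin
  (poly (c ∷ []) ⊛ s) (suc k)      ≡⟨ ⊛-suc (poly (c ∷ [])) s k ⟩
  c * s (suc k) + (poly [] ⊛ s) k  ≡⟨ cong (_+_ (c * s (suc k))) (poly-[]-⊛ s k) ⟩
  c * s (suc k) + + 0              ≡⟨ ℤ.+-identityʳ _ ⟩
  c * s (suc k)                    ∎
poly-⊛ (c ∷ c′ ∷ cs) s zero    = ⊛-zero (poly (c ∷ c′ ∷ cs)) s
poly-⊛ (c ∷ c′ ∷ cs) s (suc k) =
  trans (⊛-suc (poly (c ∷ c′ ∷ cs)) s k) (cong (_+_ (c * s (suc k))) (poly-⊛ (c′ ∷ cs) s k))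

rational-first-order : ∀ m s → s 0 ≡ + 1 → s 1 ≡ m →
                       (∀ k → s (2 ℕ.+ k) ≡ (m - + 1) * s (1 ℕ.+ k)) →
                       poly (+ 1 ∷ - (m - + 1) ∷ []) ⊛ s ≗ₚ poly (+ 1 ∷ + 1 ∷ [])
rational-first-order m s s₀ s₁ s-rec k = trans (poly-⊛ (+ 1 ∷ - c ∷ []) s k) (coefficient k)
  where
  c = m - + 1
  coefficient : ∀ k → ((+ 1 ∷ - c ∷ []) ⊙ s) k ≡ poly (+ 1 ∷ + 1 ∷ []) k
  coefficient zero = cong (+ 1 *_) s₀
  coefficient (suc zero) = begin
    + 1 * s 1 + - c * s 0  ≡⟨ cong₂ (λ a b → + 1 * a + - c * b) s₁ s₀ ⟩
    + 1 * m + - c * + 1    ≡⟨ cancel m ⟩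
    + 1                    ∎
    where
    cancel : ∀ m → + 1 * m + - (m - + 1) * + 1 ≡ + 1
    cancel = solve-∀
  coefficient (suc (suc k)) = begin
    + 1 * s (2 ℕ.+ k) + - c * s (1 ℕ.+ k)
      ≡⟨ cong (λ a → + 1 * a + - c * s (1 ℕ.+ k)) (s-rec k) ⟩
    + 1 * (c * s (1 ℕ.+ k)) + - c * s (1 ℕ.+ k)
      ≡⟨ cancel c (s (1 ℕ.+ k)) ⟩
    + 0
      ∎
    where
    cancel : ∀ c x → + 1 * (c * x) + - c * x ≡ + 0
    cancel = solve-∀

[1+q]⊛[1-cq²] : ∀ c → poly (+ 1 ∷ + 1 ∷ []) ⊛ poly (+ 1 ∷ + 0 ∷ - c ∷ [])
                        ≗ₚ poly (+ 1 ∷ + 1 ∷ - c ∷ - c ∷ [])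
[1+q]⊛[1-cq²] c k = trans (poly-⊛ (+ 1 ∷ + 1 ∷ []) (poly (+ 1 ∷ + 0 ∷ - c ∷ [])) k) (coefficient k)
  where
  coefficient : ∀ k → ((+ 1 ∷ + 1 ∷ []) ⊙ poly (+ 1 ∷ + 0 ∷ - c ∷ [])) k
                    ≡ poly (+ 1 ∷ + 1 ∷ - c ∷ - c ∷ []) k
  coefficient 0                         = refl
  coefficient 1                         = refl
  coefficient 2                         = third c
    where
    third : ∀ c → + 1 * - c + + 1 * + 0 ≡ - c
    third = solve-∀
  coefficient 3                         = fourth c
    where
    fourth : ∀ c → + 1 * + 0 + + 1 * - c ≡ - c
    fourth = solve-∀
  coefficient (suc (suc (suc (suc k)))) = refl

[1+q²]⊛[1+dq] : ∀ d → poly (+ 1 ∷ + 0 ∷ + 1 ∷ []) ⊛ poly (+ 1 ∷ d ∷ [])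
                        ≗ₚ poly (+ 1 ∷ d ∷ + 1 ∷ d ∷ [])
[1+q²]⊛[1+dq] d k = trans (poly-⊛ (+ 1 ∷ + 0 ∷ + 1 ∷ []) (poly (+ 1 ∷ d ∷ [])) k) (coefficient k)
  where
  coefficient : ∀ k → ((+ 1 ∷ + 0 ∷ + 1 ∷ []) ⊙ poly (+ 1 ∷ d ∷ [])) k
                    ≡ poly (+ 1 ∷ d ∷ + 1 ∷ d ∷ []) k
  coefficient 0                         = refl
  coefficient 1                         = second d
    where
    second : ∀ d → + 1 * d + + 0 * + 1 ≡ d
    second = solve-∀
  coefficient 2                         = refl
  coefficient 3                         = fourth d
    where
    fourth : ∀ d → + 1 * + 0 + (+ 0 * + 0 + + 1 * d) ≡ d
    fourth = solve-∀
  coefficient (suc (suc (suc (suc k)))) = refl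

qm1/qp1-suc : ∀ m → qm1/qp1 (suc m) ≡ alt m + alt m
qm1/qp1-suc m = trans (poly-⊛ (- + 1 ∷ + 1 ∷ []) inv1+q (suc m)) (double (alt m))
  where
  double : ∀ a → - + 1 * - a + + 1 * a ≡ a + a
  double = solve-∀

qm1/qp1-tail : ∀ m → qm1/qp1 (2 ℕ.+ m) + qm1/qp1 (1 ℕ.+ m) ≡ + 0
qm1/qp1-tail m = trans (cong₂ _+_ (qm1/qp1-suc (suc m)) (qm1/qp1-suc m)) (cancel (alt m))
  where
  cancel : ∀ a → (- a + - a) + (a + a) ≡ + 0
  cancel = solve-∀

-- (1 + q) · R^parity j = (−1)ʲ + q, which the next three lemmas state coefficientwise.
R^parity : ℕ → PS
R^parity j = qm1/qp1 ^ₚ (j % 2)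

R^parity-0 : ∀ j → R^parity j 0 ≡ alt j
R^parity-0 0             = refl
R^parity-0 1             = refl
R^parity-0 (suc (suc j)) = trans (R^parity-0 j) (sym (ℤ.neg-involutive (alt j)))

R^parity-1 : ∀ j → R^parity j 1 + R^parity j 0 ≡ + 1
R^parity-1 0             = refl
R^parity-1 1             = refl
R^parity-1 (suc (suc j)) = R^parity-1 j

R^parity-tail : ∀ j m → R^parity j (2 ℕ.+ m) + R^parity j (1 ℕ.+ m) ≡ + 0
R^parity-tail 0             m = refl
R^parity-tail 1             m =
  trans (cong₂ _+_ (⊛-identityʳ qm1/qp1 (2 ℕ.+ m)) (⊛-identityʳ qm1/qp1 (1 ℕ.+ m))) (qm1/qp1-tail m)
R^parity-tail (suc (suc j)) m = R^parity-tail j m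

-- Indicators and finite sums

𝟙 : {P : Set} → Dec P → ℤ
𝟙 p = indicator p (+ 1)

𝟙-cong : {P Q : Set} (p : Dec P) (q : Dec Q) → (P → Q) → (Q → P) → 𝟙 p ≡ 𝟙 q
𝟙-cong (yes _) (yes _) _   _   = refl
𝟙-cong (yes x) (no ¬y) x→y _   = contradiction (x→y x) ¬y
𝟙-cong (no ¬x) (yes y) _   y→x = contradiction (y→x y) ¬x
𝟙-cong (no _)  (no _)  _   _   = refl

𝟙-× : {P Q : Set} (p : Dec P) (q : Dec Q) → 𝟙 (p ×-dec q) ≡ 𝟙 p * 𝟙 q
𝟙-× (yes _) (yes _) = refl
𝟙-× (yes _) (no _)  = refl
𝟙-× (no _)  _       = refl

𝟙-absorb : {P Q : Set} (p : Dec P) (q : Dec Q) → (Q → P) → 𝟙 p * 𝟙 q ≡ 𝟙 q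
𝟙-absorb p q q→p = trans (sym (𝟙-× p q)) (𝟙-cong (p ×-dec q) q proj₂ (λ y → q→p y , y))

𝟙-¬ : {P : Set} (p : Dec P) → 𝟙 (¬? p) ≡ + 1 - 𝟙 p
𝟙-¬ (yes _) = refl
𝟙-¬ (no _)  = refl

indicator-via-𝟙 : {P : Set} (p : Dec P) {z z′ : ℤ} → (P → z ≡ z′) → indicator p z ≡ 𝟙 p * z′
indicator-via-𝟙 (yes x) eq = trans (eq x) (sym (ℤ.*-identityˡ _))
indicator-via-𝟙 (no _)  _  = refl

∑-one : ∀ n → ∑[ i < n ] (+ 1) ≡ + n
∑-one zero    = refl
∑-one (suc n) = cong (_+_ (+ 1)) (∑-one n)

∑-distrib-minus : ∀ {n} (f g : Fin n → ℤ) → ∑[ i < n ] (f i - g i) ≡ ∑[ i < n ] f i - ∑[ i < n ] g i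
∑-distrib-minus {zero}  f g = refl
∑-distrib-minus {suc n} f g = begin
  (f zero - g zero) + ∑[ i < n ] (f (suc i) - g (suc i))
    ≡⟨ cong (_+_ (f zero - g zero)) (∑-distrib-minus (f ∘ suc) (g ∘ suc)) ⟩
  (f zero - g zero) + (F - G)
    ≡⟨ interchange (f zero) (g zero) F G ⟩
  (f zero + F) - (g zero + G)
    ∎
  where
  F = ∑[ i < n ] f (suc i)
  G = ∑[ i < n ] g (suc i)
  interchange : ∀ a b c d → (a - b) + (c - d) ≡ (a + c) - (b + d)
  interchange = solve-∀

∑-δ : ∀ {n} (a : Fin n) (h : Fin n → ℤ) → ∑[ i < n ] (𝟙 (i ≟ a) * h i) ≡ h a
∑-δ {suc n} zero    h = trans (cong₂ _+_ (ℤ.*-identityˡ (h zero)) (sum-replicate-zero n)) (ℤ.+-identityʳ _)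
∑-δ {suc n} (suc a) h = trans (ℤ.+-identityˡ _) (∑-δ a (h ∘ suc))

∑-except : ∀ {n} (a : Fin n) (h : Fin n → ℤ) →
           ∑[ i < n ] (𝟙 (¬? (i ≟ a)) * h i) ≡ ∑[ i < n ] h i - h a
∑-except {n} a h = begin
  ∑[ i < n ] (𝟙 (¬? (i ≟ a)) * h i)
    ≡⟨ sum-cong-≗ (λ i → trans (cong (_* h i) (𝟙-¬ (i ≟ a))) (complement (𝟙 (i ≟ a)) (h i))) ⟩
  ∑[ i < n ] (h i - 𝟙 (i ≟ a) * h i)
    ≡⟨ ∑-distrib-minus h (λ i → 𝟙 (i ≟ a) * h i) ⟩
  ∑[ i < n ] h i - ∑[ i < n ] (𝟙 (i ≟ a) * h i)
    ≡⟨ cong (_-_ (∑[ i < n ] h i)) (∑-δ a h) ⟩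
  ∑[ i < n ] h i - h a
    ∎
  where
  complement : ∀ e x → (+ 1 - e) * x ≡ x - e * x
  complement = solve-∀

-- The hypothesis says that q vanishes wherever the 0/1-valued h does.
∑-off-diagonal : ∀ {n} (h q : Fin n → ℤ) → (∀ a → h a * q a ≡ q a) →
                 ∑[ i < n ] ∑[ a < n ] (h i * (𝟙 (¬? (i ≟ a)) * q a))
                   ≡ (∑[ i < n ] h i - + 1) * ∑[ a < n ] q a
∑-off-diagonal {n} h q hq = begin
  ∑[ i < n ] ∑[ a < n ] (h i * (𝟙≢ i a * q a))  ≡⟨ ∑-comm (λ i a → h i * (𝟙≢ i a * q a)) ⟩
  ∑[ a < n ] ∑[ i < n ] (h i * (𝟙≢ i a * q a))  ≡⟨ sum-cong-≗ column ⟩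
  ∑[ a < n ] ((H - + 1) * q a)                   ≡⟨ *-distribˡ-sum (H - + 1) q ⟨
  (H - + 1) * ∑[ a < n ] q a                     ∎
  where
  H = ∑[ i < n ] h i
  𝟙≢ : Fin n → Fin n → ℤ
  𝟙≢ i a = 𝟙 (¬? (i ≟ a))
  column : ∀ a → ∑[ i < n ] (h i * (𝟙≢ i a * q a)) ≡ (H - + 1) * q a
  column a = begin
    ∑[ i < n ] (h i * (𝟙≢ i a * q a))  ≡⟨ sum-cong-≗ (λ i → swap (h i) (𝟙≢ i a) (q a)) ⟩
    ∑[ i < n ] (𝟙≢ i a * h i * q a)    ≡⟨ *-distribʳ-sum (q a) (λ i → 𝟙≢ i a * h i) ⟨
    ∑[ i < n ] (𝟙≢ i a * h i) * q a    ≡⟨ cong (_* q a) (∑-except a h) ⟩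
    (H - h a) * q a                    ≡⟨ distrib H (h a) (q a) ⟩
    H * q a - h a * q a                ≡⟨ cong (_-_ (H * q a)) (hq a) ⟩
    H * q a - q a                      ≡⟨ factor H (q a) ⟩
    (H - + 1) * q a                    ∎
    where
    swap : ∀ x e y → x * (e * y) ≡ e * x * y
    swap = solve-∀
    distrib : ∀ x y z → (x - y) * z ≡ x * z - y * z
    distrib = solve-∀
    factor : ∀ x z → x * z - z ≡ (x - + 1) * z
    factor = solve-∀

-- Sums over words

sumℤ-++ : ∀ xs ys → sumℤ (xs ++ ys) ≡ sumℤ xs + sumℤ ys
sumℤ-++ []       ys = sym (ℤ.+-identityˡ _)
sumℤ-++ (x ∷ xs) ys = trans (cong (_+_ x) (sumℤ-++ xs ys)) (sym (ℤ.+-assoc x _ _))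

sumℤ-map-concatMap : ∀ {A B : Set} (g : B → ℤ) (h : A → List B) xs →
                     sumℤ (map g (concatMap h xs)) ≡ sumℤ (map (λ x → sumℤ (map g (h x))) xs)
sumℤ-map-concatMap g h []       = refl
sumℤ-map-concatMap g h (x ∷ xs) = begin
  sumℤ (map g (h x ++ concatMap h xs))
    ≡⟨ cong sumℤ (List.map-++ g (h x) (concatMap h xs)) ⟩
  sumℤ (map g (h x) ++ map g (concatMap h xs))
    ≡⟨ sumℤ-++ (map g (h x)) _ ⟩
  sumℤ (map g (h x)) + sumℤ (map g (concatMap h xs))
    ≡⟨ cong (_+_ (sumℤ (map g (h x)))) (sumℤ-map-concatMap g h xs) ⟩
  sumℤ (map g (h x)) + sumℤ (map (λ x → sumℤ (map g (h x))) xs)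
    ∎

sumℤ-tabulate : ∀ {n} (f : Fin n → ℤ) → sumℤ (tabulate f) ≡ ∑[ i < n ] f i
sumℤ-tabulate {zero}  f = refl
sumℤ-tabulate {suc n} f = cong (_+_ (f zero)) (sumℤ-tabulate (f ∘ suc))

sumℤ-map-allFin : ∀ {n} (f : Fin n → ℤ) → sumℤ (map f (allFin n)) ≡ ∑[ i < n ] f i
sumℤ-map-allFin f = trans (cong sumℤ (List.map-tabulate id f)) (sumℤ-tabulate f)

sumℤ-map-*ˡ : ∀ {A : Set} c (g : A → ℤ) xs → sumℤ (map (λ x → c * g x) xs) ≡ c * sumℤ (map g xs)
sumℤ-map-*ˡ c g []       = sym (ℤ.*-zeroʳ c)
sumℤ-map-*ˡ c g (x ∷ xs) =
  trans (cong (_+_ (c * g x)) (sumℤ-map-*ˡ c g xs)) (sym (ℤ.*-distribˡ-+ c (g x) _))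

+length-filter : ∀ {A : Set} {P : A → Set} (P? : Decidable P) xs →
                 + length (filter P? xs) ≡ sumℤ (map (𝟙 ∘ P?) xs)
+length-filter P? []       = refl
+length-filter P? (x ∷ xs) with P? x
... | yes _ = cong (_+_ (+ 1)) (+length-filter P? xs)
... | no  _ = trans (+length-filter P? xs) (sym (ℤ.+-identityˡ _))

sumWords : ∀ n → ℕ → (Word n → ℤ) → ℤ
sumWords n k g = sumℤ (map g (wordsOfLength n k))

module _ {n : ℕ} where

  sumWords-suc : ∀ k (g : Word n → ℤ) → sumWords n (suc k) g ≡ ∑[ i < n ] sumWords n k (g ∘ (i ∷_))
  sumWords-suc k g = begin
    sumℤ (map g (concatMap (λ i → map (i ∷_) W) (allFin n)))
      ≡⟨ sumℤ-map-concatMap g (λ i → map (i ∷_) W) (allFin n) ⟩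
    sumℤ (map (λ i → sumℤ (map g (map (i ∷_) W))) (allFin n))
      ≡⟨ sumℤ-map-allFin (λ i → sumℤ (map g (map (i ∷_) W))) ⟩
    ∑[ i < n ] sumℤ (map g (map (i ∷_) W))
      ≡⟨ sum-cong-≗ (λ i → cong sumℤ (List.map-∘ {g = g} {f = i ∷_} W)) ⟨
    ∑[ i < n ] sumWords n k (g ∘ (i ∷_))
      ∎
    where
    W = wordsOfLength n k

  sumWords-cong : ∀ k {g h : Word n → ℤ} → (∀ w → length w ≡ k → g w ≡ h w) →
                  sumWords n k g ≡ sumWords n k h
  sumWords-cong zero    eq = cong (λ x → x + + 0) (eq [] refl)
  sumWords-cong (suc k) {g} {h} eq = begin
    sumWords n (suc k) g
      ≡⟨ sumWords-suc k g ⟩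
    ∑[ i < n ] sumWords n k (g ∘ (i ∷_))
      ≡⟨ sum-cong-≗ (λ i → sumWords-cong k (λ w |w| → eq (i ∷ w) (cong suc |w|))) ⟩
    ∑[ i < n ] sumWords n k (h ∘ (i ∷_))
      ≡⟨ sumWords-suc k h ⟨
    sumWords n (suc k) h
      ∎

  sumWords-∷ʳ : ∀ k (g : Word n → ℤ) →
                sumWords n (suc k) g ≡ sumWords n k (λ w → ∑[ x < n ] g (w ∷ʳ x))
  sumWords-∷ʳ zero    g = begin
    sumWords n 1 g                       ≡⟨ sumWords-suc 0 g ⟩
    ∑[ x < n ] (g (x ∷ []) + + 0)        ≡⟨ sum-cong-≗ (λ x → ℤ.+-identityʳ (g (x ∷ []))) ⟩
    ∑[ x < n ] g (x ∷ [])                ≡⟨ ℤ.+-identityʳ (∑[ x < n ] g (x ∷ [])) ⟨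
    ∑[ x < n ] g (x ∷ []) + + 0          ∎
  sumWords-∷ʳ (suc k) g = begin
    sumWords n (2 ℕ.+ k) g
      ≡⟨ sumWords-suc (suc k) g ⟩
    ∑[ i < n ] sumWords n (suc k) (g ∘ (i ∷_))
      ≡⟨ sum-cong-≗ (λ i → sumWords-∷ʳ k (g ∘ (i ∷_))) ⟩
    ∑[ i < n ] sumWords n k (λ w → ∑[ x < n ] g (i ∷ (w ∷ʳ x)))
      ≡⟨ sumWords-suc k (λ w → ∑[ x < n ] g (w ∷ʳ x)) ⟨
    sumWords n (suc k) (λ w → ∑[ x < n ] g (w ∷ʳ x))
      ∎

  sumWords-*ˡ : ∀ k c (g : Word n → ℤ) → sumWords n k (λ w → c * g w) ≡ c * sumWords n k g
  sumWords-*ˡ k c g = sumℤ-map-*ˡ c g (wordsOfLength n k)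

  sumWords-*ʳ : ∀ k c (g : Word n → ℤ) → sumWords n k (λ w → g w * c) ≡ sumWords n k g * c
  sumWords-*ʳ k c g = begin
    sumWords n k (λ w → g w * c)  ≡⟨ sumWords-cong k (λ w _ → ℤ.*-comm (g w) c) ⟩
    sumWords n k (λ w → c * g w)  ≡⟨ sumWords-*ˡ k c g ⟩
    c * sumWords n k g            ≡⟨ ℤ.*-comm c _ ⟩
    sumWords n k g * c            ∎

-- Reduced words over an alphabet

module ReducedOver {n : ℕ} {A : Fin n → Set} (A? : Decidable A) where

  reducedOver? : (w : Word n) → Dec (Reduced w × All A w)
  reducedOver? w = reduced? w ×-dec all? A? w

  χ : Word n → ℤ
  χ w = 𝟙 (reducedOver? w)

  count : ℕ → ℤ
  count k = sumWords n k χ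

  #A : ℤ
  #A = ∑[ i < n ] 𝟙 (A? i)

  count-1 : count 1 ≡ #A
  count-1 = trans (sumWords-suc 0 χ) (sum-cong-≗ (λ i → trans (ℤ.+-identityʳ _)
    (𝟙-cong (reducedOver? (i ∷ [])) (A? i) (λ { (_ , a ∷ []) → a }) (λ a → tt , a ∷ []))))

  private
    startingWith : ℕ → Fin n → ℤ
    startingWith k i = sumWords n k (χ ∘ (i ∷_))

    χ-∷∷ : ∀ i a w → χ (i ∷ a ∷ w) ≡ 𝟙 (A? i) * (𝟙 (¬? (i ≟ a)) * χ (a ∷ w))
    χ-∷∷ i a w = begin
      χ (i ∷ a ∷ w)
        ≡⟨ 𝟙-cong (reducedOver? (i ∷ a ∷ w)) split to from ⟩
      𝟙 split
        ≡⟨ 𝟙-× (A? i) (¬? (i ≟ a) ×-dec reducedOver? (a ∷ w)) ⟩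
      𝟙 (A? i) * 𝟙 (¬? (i ≟ a) ×-dec reducedOver? (a ∷ w))
        ≡⟨ cong (𝟙 (A? i) *_) (𝟙-× (¬? (i ≟ a)) (reducedOver? (a ∷ w))) ⟩
      𝟙 (A? i) * (𝟙 (¬? (i ≟ a)) * χ (a ∷ w))
        ∎
      where
      split = A? i ×-dec (¬? (i ≟ a) ×-dec reducedOver? (a ∷ w))
      to : Reduced (i ∷ a ∷ w) × All A (i ∷ a ∷ w) →
           A i × (i ≢ a) × Reduced (a ∷ w) × All A (a ∷ w)
      to ((i≢a , r) , (Ai ∷ As)) = Ai , i≢a , r , As
      from : A i × (i ≢ a) × Reduced (a ∷ w) × All A (a ∷ w) →
             Reduced (i ∷ a ∷ w) × All A (i ∷ a ∷ w)
      from (Ai , i≢a , r , As) = (i≢a , r) , (Ai ∷ As)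

    startingWith-suc : ∀ k i →
                       startingWith (suc k) i ≡ ∑[ a < n ] (𝟙 (A? i) * (𝟙 (¬? (i ≟ a)) * startingWith k a))
    startingWith-suc k i = trans (sumWords-suc k (χ ∘ (i ∷_))) (sum-cong-≗ λ a → begin
      sumWords n k (λ w → χ (i ∷ a ∷ w))
        ≡⟨ sumWords-cong k (λ w _ → χ-∷∷ i a w) ⟩
      sumWords n k (λ w → 𝟙 (A? i) * (𝟙 (¬? (i ≟ a)) * χ (a ∷ w)))
        ≡⟨ sumWords-*ˡ k (𝟙 (A? i)) _ ⟩
      𝟙 (A? i) * sumWords n k (λ w → 𝟙 (¬? (i ≟ a)) * χ (a ∷ w))
        ≡⟨ cong (𝟙 (A? i) *_) (sumWords-*ˡ k (𝟙 (¬? (i ≟ a))) _) ⟩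
      𝟙 (A? i) * (𝟙 (¬? (i ≟ a)) * startingWith k a)
        ∎)

    startingWith-letter : ∀ k a → 𝟙 (A? a) * startingWith k a ≡ startingWith k a
    startingWith-letter k a = trans (sym (sumWords-*ˡ k (𝟙 (A? a)) (χ ∘ (a ∷_))))
      (sumWords-cong k (λ w _ → 𝟙-absorb (A? a) (reducedOver? (a ∷ w)) (λ { (_ , Aa ∷ _) → Aa })))

  count-suc-suc : ∀ k → count (2 ℕ.+ k) ≡ (#A - + 1) * count (1 ℕ.+ k)
  count-suc-suc k = begin
    count (2 ℕ.+ k)
      ≡⟨ sumWords-suc (suc k) χ ⟩
    ∑[ i < n ] startingWith (suc k) i
      ≡⟨ sum-cong-≗ (startingWith-suc k) ⟩
    ∑[ i < n ] ∑[ a < n ] (𝟙 (A? i) * (𝟙 (¬? (i ≟ a)) * startingWith k a))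
      ≡⟨ ∑-off-diagonal (𝟙 ∘ A?) (startingWith k) (startingWith-letter k) ⟩
    (#A - + 1) * ∑[ a < n ] startingWith k a
      ≡⟨ cong ((#A - + 1) *_) (sumWords-suc k χ) ⟨
    (#A - + 1) * count (1 ℕ.+ k)
      ∎

map-id-local⁻ : ∀ {A : Set} {f : A → A} xs → map f xs ≡ xs → All (λ x → f x ≡ x) xs
map-id-local⁻ []       _  = []
map-id-local⁻ (x ∷ xs) eq = List.∷-injectiveˡ eq ∷ map-id-local⁻ xs (List.∷-injectiveʳ eq)

fixedCount-∑ : ∀ {n} (σ : Fin n → Fin n) → + fixedCount σ ≡ ∑[ i < n ] 𝟙 (σ i ≟ i)
fixedCount-∑ {n} σ =
  trans (+length-filter (λ i → σ i ≟ i) (allFin n)) (sumℤ-map-allFin (λ i → 𝟙 (σ i ≟ i)))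

P-rational : ∀ n → poly (+ 1 ∷ - (+ n - + 1) ∷ []) ⊛ Pser n ≗ₚ poly (+ 1 ∷ + 1 ∷ [])
P-rational n = rational-first-order (+ n) (Pser n) refl Pser-1 Pser-suc-suc
  where
  open ReducedOver (U? {A = Fin n})

  Pser≡count : ∀ k → Pser n k ≡ count k
  Pser≡count k = sumWords-cong k (λ w _ →
    𝟙-cong (reduced? w) (reducedOver? w) (λ r → r , universal-U w) proj₁)

  Pser-1 : Pser n 1 ≡ + n
  Pser-1 = trans (Pser≡count 1) (trans count-1 (∑-one n))

  Pser-suc-suc : ∀ k → Pser n (2 ℕ.+ k) ≡ (+ n - + 1) * Pser n (1 ℕ.+ k)
  Pser-suc-suc k = trans (Pser≡count (2 ℕ.+ k)) (trans (count-suc-suc k)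
    (cong₂ (λ m c → (m - + 1) * c) (∑-one n) (sym (Pser≡count (1 ℕ.+ k)))))

F-rational : ∀ {n} (σ : Fin n → Fin n) →
             poly (+ 1 ∷ - (+ fixedCount σ - + 1) ∷ []) ⊛ Fser σ ≗ₚ poly (+ 1 ∷ + 1 ∷ [])
F-rational {n} σ = rational-first-order (+ fixedCount σ) (Fser σ) refl Fser-1 Fser-suc-suc
  where
  open ReducedOver (λ i → σ i ≟ i)

  Fser≡count : ∀ k → Fser σ k ≡ count k
  Fser≡count k = sumWords-cong k (λ w _ →
    𝟙-cong (reduced? w ×-dec List.≡-dec _≟_ (map σ w) w) (reducedOver? w)
           (λ (r , σw≡w) → r , map-id-local⁻ w σw≡w) (λ (r , fixed) → r , List.map-id-local fixed))

  Fser-1 : Fser σ 1 ≡ + fixedCount σ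
  Fser-1 = trans (Fser≡count 1) (trans count-1 (sym (fixedCount-∑ σ)))

  Fser-suc-suc : ∀ k → Fser σ (2 ℕ.+ k) ≡ (+ fixedCount σ - + 1) * Fser σ (1 ℕ.+ k)
  Fser-suc-suc k = trans (Fser≡count (2 ℕ.+ k)) (trans (count-suc-suc k)
    (cong₂ (λ m c → (m - + 1) * c) (sym (fixedCount-∑ σ)) (sym (Fser≡count (1 ℕ.+ k)))))

-- Reduced words and twisted involutions

length-∷ʳ : ∀ {A : Set} (w : List A) x → length (w ∷ʳ x) ≡ suc (length w)
length-∷ʳ w x = trans (List.length-++ w) (ℕ.+-comm (length w) 1)

reverse-∷-∷ʳ : ∀ {A : Set} (i : A) u x → reverse (i ∷ (u ∷ʳ x)) ≡ x ∷ (reverse u ∷ʳ i)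
reverse-∷-∷ʳ i u x = begin
  reverse (i ∷ (u ∷ʳ x))  ≡⟨ List.unfold-reverse i (u ∷ʳ x) ⟩
  reverse (u ∷ʳ x) ∷ʳ i   ≡⟨ cong (_∷ʳ i) (List.reverse-++ u (x ∷ [])) ⟩
  x ∷ (reverse u ∷ʳ i)    ∎

ends-induction : ∀ {A : Set} (P : List A → Set) → P [] → (∀ x → P (x ∷ [])) →
                 (∀ x u y → P u → P (x ∷ (u ∷ʳ y))) → ∀ w → P w
ends-induction P nil one step w = go (length w) w ℕ.≤-refl
  where
  go : ∀ k w → length w ≤ k → P w
  go _       []      _           = nil
  go (suc k) (x ∷ v) (s≤s |v|≤k) with initLast v
  ... | []      = one x
  ... | u ∷ʳ′ y = step x u y (go k u (ℕ.≤-trans (ℕ.n≤1+n _) (subst (_≤ k) (length-∷ʳ u y) |v|≤k)))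

module _ {n : ℕ} where

  Reduced-∷⁻ : ∀ x (w : Word n) → Reduced (x ∷ w) → Reduced w
  Reduced-∷⁻ x []      _       = tt
  Reduced-∷⁻ x (y ∷ w) (_ , r) = r

  Reduced-∷ʳ⁻ : ∀ (w : Word n) x → Reduced (w ∷ʳ x) → Reduced w
  Reduced-∷ʳ⁻ []          x _         = tt
  Reduced-∷ʳ⁻ (y ∷ [])    x _         = tt
  Reduced-∷ʳ⁻ (y ∷ z ∷ w) x (y≢z , r) = y≢z , Reduced-∷ʳ⁻ (z ∷ w) x r

  Reduced-∷ʳ⁺ : ∀ (w : Word n) y z → Reduced (w ∷ʳ y) → y ≢ z → Reduced (w ∷ʳ y ∷ʳ z)
  Reduced-∷ʳ⁺ []           y z _          y≢z = y≢z , tt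
  Reduced-∷ʳ⁺ (x ∷ [])     y z (x≢y , _)  y≢z = x≢y , y≢z , tt
  Reduced-∷ʳ⁺ (x ∷ x′ ∷ w) y z (x≢x′ , r) y≢z = x≢x′ , Reduced-∷ʳ⁺ (x′ ∷ w) y z r y≢z

  ·ʳ-reduced : ∀ (w : Word n) s → Reduced (w ∷ʳ s) → w ·ʳ s ≡ w ∷ʳ s
  ·ʳ-reduced []          s _ = refl
  ·ʳ-reduced (x ∷ [])    s (x≢s , _) with x ≟ s
  ... | yes x≡s = contradiction x≡s x≢s
  ... | no  _   = refl
  ·ʳ-reduced (x ∷ y ∷ w) s (_ , r) = cong (x ∷_) (·ʳ-reduced (y ∷ w) s r)

  ·ˡ-reduced : ∀ s (w : Word n) → Reduced (s ∷ w) → s ·ˡ w ≡ s ∷ w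
  ·ˡ-reduced s []      _         = refl
  ·ˡ-reduced s (x ∷ w) (s≢x , _) with s ≟ x
  ... | yes s≡x = contradiction s≡x s≢x
  ... | no  _   = refl

  ·ˡ-·ʳ-reduced : ∀ s (w : Word n) t → Reduced (s ∷ (w ∷ʳ t)) → s ·ˡ (w ·ʳ t) ≡ s ∷ (w ∷ʳ t)
  ·ˡ-·ʳ-reduced s w t r =
    trans (cong (s ·ˡ_) (·ʳ-reduced w t (Reduced-∷⁻ s (w ∷ʳ t) r))) (·ˡ-reduced s (w ∷ʳ t) r)

module TwistedInvolutions {n : ℕ} (σ : Fin n → Fin n) (σ-involutive : ∀ i → σ (σ i) ≡ i) where

  σ-injective : ∀ {a b} → σ a ≡ σ b → a ≡ b
  σ-injective {a} {b} eq = trans (sym (σ-involutive a)) (trans (cong σ eq) (σ-involutive b))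

  twisted-∷∷ʳ⁻ : ∀ i u x → Twisted σ (i ∷ (u ∷ʳ x)) → x ≡ σ i × Twisted σ u
  twisted-∷∷ʳ⁻ i u x t =
    List.∷-injectiveˡ eq , proj₁ (List.∷ʳ-injective (reverse u) (map σ u) (List.∷-injectiveʳ eq))
    where
    eq : x ∷ (reverse u ∷ʳ i) ≡ σ i ∷ (map σ u ∷ʳ σ x)
    eq = trans (sym (reverse-∷-∷ʳ i u x)) (trans t (cong (σ i ∷_) (List.map-++ σ u (x ∷ []))))

  twisted-∷∷ʳ⁺ : ∀ i u → Twisted σ u → Twisted σ (i ∷ (u ∷ʳ σ i))
  twisted-∷∷ʳ⁺ i u t = begin
    reverse (i ∷ (u ∷ʳ σ i))    ≡⟨ reverse-∷-∷ʳ i u (σ i) ⟩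
    σ i ∷ (reverse u ∷ʳ i)      ≡⟨ cong₂ (λ v y → σ i ∷ (v ∷ʳ y)) t (sym (σ-involutive i)) ⟩
    σ i ∷ (map σ u ∷ʳ σ (σ i))  ≡⟨ cong (σ i ∷_) (List.map-++ σ u (σ i ∷ [])) ⟨
    map σ (i ∷ (u ∷ʳ σ i))      ∎

  -- The last letter of a twisted word a ∷ v is σ a, which differs from σ i when a ≢ i.
  reduced-∷∷ʳ⁺ : ∀ i a v → i ≢ a → Reduced (a ∷ v) → Twisted σ (a ∷ v) →
                 Reduced (i ∷ a ∷ (v ∷ʳ σ i))
  reduced-∷∷ʳ⁺ i a v i≢a r t with initLast v
  ... | []      = i≢a , (λ a≡σi → i≢a (σ-injective (trans (sym a≡σi) (List.∷-injectiveˡ t)))) , tt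
  ... | u ∷ʳ′ z = i≢a , Reduced-∷ʳ⁺ (a ∷ u) z (σ i) r z≢σi
    where
    z≢σi : z ≢ σ i
    z≢σi z≡σi = i≢a (sym (σ-injective (trans (sym (proj₁ (twisted-∷∷ʳ⁻ a u z t))) z≡σi)))

  reducedTwisted? : (w : Word n) → Dec (Reduced w × Twisted σ w)
  reducedTwisted? w = reduced? w ×-dec twisted? σ w

  τ : Word n → ℤ
  τ w = 𝟙 (reducedTwisted? w)

  τ-[_] : ∀ a → τ (a ∷ []) ≡ 𝟙 (σ a ≟ a)
  τ-[ a ] = 𝟙-cong (reducedTwisted? (a ∷ [])) (σ a ≟ a)
    (λ (_ , t) → sym (List.∷-injectiveˡ t)) (λ σa≡a → tt , cong (_∷ []) (sym σa≡a))

  τ-[_,_] : ∀ i x → τ (i ∷ x ∷ []) ≡ 𝟙 (x ≟ σ i) * 𝟙 (¬? (σ i ≟ i))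
  τ-[ i , x ] = trans (𝟙-cong (reducedTwisted? (i ∷ x ∷ [])) ((x ≟ σ i) ×-dec ¬? (σ i ≟ i)) to from)
                      (𝟙-× (x ≟ σ i) (¬? (σ i ≟ i)))
    where
    to : Reduced (i ∷ x ∷ []) × Twisted σ (i ∷ x ∷ []) → x ≡ σ i × σ i ≢ i
    to ((i≢x , _) , t) = x≡σi , λ σi≡i → i≢x (sym (trans x≡σi σi≡i))
      where
      x≡σi = proj₁ (twisted-∷∷ʳ⁻ i [] x t)
    from : x ≡ σ i × σ i ≢ i → Reduced (i ∷ x ∷ []) × Twisted σ (i ∷ x ∷ [])
    from (x≡σi , σi≢i) = ((λ i≡x → σi≢i (sym (trans i≡x x≡σi))) , tt)
                       , subst (λ y → Twisted σ (i ∷ y ∷ [])) (sym x≡σi) (twisted-∷∷ʳ⁺ i [] refl)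

  τ-∷∷∷ʳ : ∀ i a v x → τ (i ∷ a ∷ (v ∷ʳ x)) ≡ 𝟙 (x ≟ σ i) * (𝟙 (¬? (i ≟ a)) * τ (a ∷ v))
  τ-∷∷∷ʳ i a v x = begin
    τ (i ∷ a ∷ (v ∷ʳ x))
      ≡⟨ 𝟙-cong (reducedTwisted? (i ∷ a ∷ (v ∷ʳ x))) split to from ⟩
    𝟙 split
      ≡⟨ 𝟙-× (x ≟ σ i) (¬? (i ≟ a) ×-dec reducedTwisted? (a ∷ v)) ⟩
    𝟙 (x ≟ σ i) * 𝟙 (¬? (i ≟ a) ×-dec reducedTwisted? (a ∷ v))
      ≡⟨ cong (𝟙 (x ≟ σ i) *_) (𝟙-× (¬? (i ≟ a)) (reducedTwisted? (a ∷ v))) ⟩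
    𝟙 (x ≟ σ i) * (𝟙 (¬? (i ≟ a)) * τ (a ∷ v))
      ∎
    where
    split = (x ≟ σ i) ×-dec (¬? (i ≟ a) ×-dec reducedTwisted? (a ∷ v))
    to : Reduced (i ∷ a ∷ (v ∷ʳ x)) × Twisted σ (i ∷ a ∷ (v ∷ʳ x)) →
         x ≡ σ i × i ≢ a × Reduced (a ∷ v) × Twisted σ (a ∷ v)
    to ((i≢a , r) , t) = let (x≡σi , ta) = twisted-∷∷ʳ⁻ i (a ∷ v) x t in
                         x≡σi , i≢a , Reduced-∷ʳ⁻ (a ∷ v) x r , ta
    from : x ≡ σ i × i ≢ a × Reduced (a ∷ v) × Twisted σ (a ∷ v) →
           Reduced (i ∷ a ∷ (v ∷ʳ x)) × Twisted σ (i ∷ a ∷ (v ∷ʳ x))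
    from (x≡σi , i≢a , r , ta) =
      subst (λ y → Reduced (i ∷ a ∷ (v ∷ʳ y)) × Twisted σ (i ∷ a ∷ (v ∷ʳ y))) (sym x≡σi)
            (reduced-∷∷ʳ⁺ i a v i≢a r ta , twisted-∷∷ʳ⁺ i (a ∷ v) ta)

  twistedCount : ℕ → ℤ
  twistedCount k = sumWords n k τ

  #fixed : ℤ
  #fixed = ∑[ i < n ] 𝟙 (σ i ≟ i)

  twistedCount-1 : twistedCount 1 ≡ #fixed
  twistedCount-1 = trans (sumWords-suc 0 τ) (sum-cong-≗ (λ a → trans (ℤ.+-identityʳ _) τ-[ a ]))

  twistedCount-2 : twistedCount 2 ≡ + n - #fixed
  twistedCount-2 = begin
    twistedCount 2
      ≡⟨ sumWords-suc 1 τ ⟩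
    ∑[ i < n ] sumWords n 1 (τ ∘ (i ∷_))
      ≡⟨ sum-cong-≗ (λ i → trans (sumWords-suc 0 (τ ∘ (i ∷_)))
                                 (sum-cong-≗ (λ x → ℤ.+-identityʳ (τ (i ∷ x ∷ []))))) ⟩
    ∑[ i < n ] ∑[ x < n ] τ (i ∷ x ∷ [])
      ≡⟨ sum-cong-≗ (λ i → trans (sum-cong-≗ τ-[ i ,_]) (∑-δ (σ i) _)) ⟩
    ∑[ i < n ] 𝟙 (¬? (σ i ≟ i))
      ≡⟨ sum-cong-≗ (λ i → 𝟙-¬ (σ i ≟ i)) ⟩
    ∑[ i < n ] (+ 1 - 𝟙 (σ i ≟ i))
      ≡⟨ ∑-distrib-minus (λ _ → + 1) (λ i → 𝟙 (σ i ≟ i)) ⟩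
    ∑[ i < n ] (+ 1) - #fixed
      ≡⟨ cong (_- #fixed) (∑-one n) ⟩
    + n - #fixed
      ∎

  private
    startingWith : ℕ → Fin n → ℤ
    startingWith k i = sumWords n k (τ ∘ (i ∷_))

    -- The reduced twisted words of length k + 3 are the i ∷ a ∷ v ∷ʳ σ i
    -- with a ∷ v reduced twisted and i ≢ a.
    startingWith-suc-suc : ∀ k i →
                           startingWith (2 ℕ.+ k) i ≡ ∑[ a < n ] (𝟙 (¬? (i ≟ a)) * startingWith k a)
    startingWith-suc-suc k i = begin
      startingWith (2 ℕ.+ k) i
        ≡⟨ sumWords-∷ʳ (suc k) (τ ∘ (i ∷_)) ⟩
      sumWords n (suc k) (λ w → ∑[ x < n ] τ (i ∷ (w ∷ʳ x)))
        ≡⟨ sumWords-suc k (λ w → ∑[ x < n ] τ (i ∷ (w ∷ʳ x))) ⟩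
      ∑[ a < n ] sumWords n k (λ v → ∑[ x < n ] τ (i ∷ a ∷ (v ∷ʳ x)))
        ≡⟨ sum-cong-≗ (λ a → sumWords-cong k (λ v _ →
             trans (sum-cong-≗ (τ-∷∷∷ʳ i a v)) (∑-δ (σ i) _))) ⟩
      ∑[ a < n ] sumWords n k (λ v → 𝟙 (¬? (i ≟ a)) * τ (a ∷ v))
        ≡⟨ sum-cong-≗ (λ a → sumWords-*ˡ k (𝟙 (¬? (i ≟ a))) (τ ∘ (a ∷_))) ⟩
      ∑[ a < n ] (𝟙 (¬? (i ≟ a)) * startingWith k a)
        ∎

  twistedCount-suc-suc-suc : ∀ k → twistedCount (3 ℕ.+ k) ≡ (+ n - + 1) * twistedCount (1 ℕ.+ k)
  twistedCount-suc-suc-suc k = begin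
    twistedCount (3 ℕ.+ k)
      ≡⟨ sumWords-suc (2 ℕ.+ k) τ ⟩
    ∑[ i < n ] startingWith (2 ℕ.+ k) i
      ≡⟨ sum-cong-≗ (λ i → trans (startingWith-suc-suc k i)
           (sum-cong-≗ (λ a → sym (ℤ.*-identityˡ (𝟙 (¬? (i ≟ a)) * startingWith k a))))) ⟩
    ∑[ i < n ] ∑[ a < n ] (+ 1 * (𝟙 (¬? (i ≟ a)) * startingWith k a))
      ≡⟨ ∑-off-diagonal (λ _ → + 1) (startingWith k) (λ a → ℤ.*-identityˡ _) ⟩
    (∑[ i < n ] (+ 1) - + 1) * ∑[ a < n ] startingWith k a
      ≡⟨ cong₂ (λ m c → (m - + 1) * c) (∑-one n) (sym (sumWords-suc k τ)) ⟩
    (+ n - + 1) * twistedCount (1 ℕ.+ k)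
      ∎

  ℓ'-parity : ∀ {ℓ'} → IsLengthPrime σ ℓ' → ∀ w → Reduced w → Twisted σ w → ℓ' w ≡ ℓ w % 2
  ℓ'-parity {ℓ'} (ℓ'[]≡0 , ℓ'-conjugate , ℓ'-step) = ends-induction _ (λ _ _ → ℓ'[]≡0) one ends
    where
    one : ∀ x → Reduced (x ∷ []) → Twisted σ (x ∷ []) → ℓ' (x ∷ []) ≡ 1
    one x _ t = ℤ.+-injective (begin
      + ℓ' (x ∷ [])            ≡⟨ ℤ.+-identityʳ _ ⟨
      + ℓ' (x ∷ []) - + 0      ≡⟨ cong (λ m → + ℓ' (x ∷ []) - + m) ℓ'[]≡0 ⟨
      + ℓ' (x ∷ []) - + ℓ' []  ≡⟨ ℓ'-step [] x tt refl t ⟩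
      + 1                      ∎)
    ends : ∀ i u x → (Reduced u → Twisted σ u → ℓ' u ≡ ℓ u % 2) →
           Reduced (i ∷ (u ∷ʳ x)) → Twisted σ (i ∷ (u ∷ʳ x)) →
           ℓ' (i ∷ (u ∷ʳ x)) ≡ ℓ (i ∷ (u ∷ʳ x)) % 2
    ends i u x ih r t with twisted-∷∷ʳ⁻ i u x t
    ... | refl , tu = begin
      ℓ' (i ∷ (u ∷ʳ σ i))     ≡⟨ cong ℓ' (·ˡ-·ʳ-reduced i u (σ i) r) ⟨
      ℓ' (i ·ˡ (u ·ʳ σ i))    ≡⟨ ℓ'-conjugate u i ru tu ⟩
      ℓ' u                    ≡⟨ ih ru tu ⟩
      ℓ u % 2                 ≡⟨ cong (λ m → suc m % 2) (length-∷ʳ u (σ i)) ⟨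
      ℓ (i ∷ (u ∷ʳ σ i)) % 2  ∎
      where
      ru = Reduced-∷ʳ⁻ u (σ i) (Reduced-∷⁻ i (u ∷ʳ σ i) r)

  module _ {ℓ' : Word n → ℕ} (isLengthPrime : IsLengthPrime σ ℓ') where

    private
      L = Lser σ ℓ'
      T = twistedCount
      N = + n - + 1

    Lser-∑qʲ : L ≗ₚ ∑qʲ (λ j m → T j * R^parity j m)
    Lser-∑qʲ = ∑qʲ-cong {g = weighted}
      (λ j m → trans (sumWords-cong j (parity-weight j m)) (sumWords-*ʳ j (R^parity j m) τ))
      where
      weighted : ℕ → PS
      weighted j m = sumWords n j (λ w → indicator (reducedTwisted? w) ((qm1/qp1 ^ₚ ℓ' w) m))
      parity-weight : ∀ j m w → length w ≡ j →
                      indicator (reducedTwisted? w) ((qm1/qp1 ^ₚ ℓ' w) m) ≡ τ w * R^parity j m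
      parity-weight j m w |w|≡j = indicator-via-𝟙 (reducedTwisted? w) λ (r , t) →
        cong (λ p → (qm1/qp1 ^ₚ p) m) (trans (ℓ'-parity isLengthPrime w r t) (cong (_% 2) |w|≡j))

    Lser-0 : L 0 ≡ + 1
    Lser-0 = Lser-∑qʲ 0

    -- adjacentSum j is the coefficient of q^(j+1) in (1 + q) · Lser.
    adjacentSum : ℕ → ℤ
    adjacentSum j = L (suc j) + L j

    adjacentSum-alternating : ∀ k → adjacentSum k ≡ alt (suc k) * T (suc k) + T k
    adjacentSum-alternating k = begin
      L (suc k) + L k                ≡⟨ cong₂ _+_ (Lser-∑qʲ (suc k)) (Lser-∑qʲ k) ⟩
      ∑qʲ g (suc k) + ∑qʲ g k        ≡⟨ ∑qʲ-telescope g tail k ⟩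
      g (suc k) 0 + (g k 1 + g k 0)  ≡⟨ cong₂ _+_ head (trans (sym (ℤ.*-distribˡ-+ (T k) _ _))
                                          (trans (cong (T k *_) (R^parity-1 k)) (ℤ.*-identityʳ (T k)))) ⟩
      alt (suc k) * T (suc k) + T k  ∎
      where
      g : ℕ → PS
      g j m = T j * R^parity j m
      tail : ∀ j m → g j (2 ℕ.+ m) + g j (1 ℕ.+ m) ≡ + 0
      tail j m = trans (sym (ℤ.*-distribˡ-+ (T j) _ _))
                       (trans (cong (T j *_) (R^parity-tail j m)) (ℤ.*-zeroʳ (T j)))
      head : g (suc k) 0 ≡ alt (suc k) * T (suc k)
      head = trans (cong (T (suc k) *_) (R^parity-0 (suc k))) (ℤ.*-comm (T (suc k)) _)

    adjacentSum-0 : adjacentSum 0 ≡ + 1 - #fixed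
    adjacentSum-0 = begin
      adjacentSum 0          ≡⟨ adjacentSum-alternating 0 ⟩
      - + 1 * T 1 + + 1      ≡⟨ cong (λ t → - + 1 * t + + 1) twistedCount-1 ⟩
      - + 1 * #fixed + + 1   ≡⟨ ring #fixed ⟩
      + 1 - #fixed           ∎
      where
      ring : ∀ F → - + 1 * F + + 1 ≡ + 1 - F
      ring = solve-∀

    adjacentSum-1 : adjacentSum 1 ≡ + n
    adjacentSum-1 = begin
      adjacentSum 1                  ≡⟨ adjacentSum-alternating 1 ⟩
      + 1 * T 2 + T 1                ≡⟨ cong₂ (λ t₂ t₁ → + 1 * t₂ + t₁) twistedCount-2 twistedCount-1 ⟩
      + 1 * (+ n - #fixed) + #fixed  ≡⟨ ring (+ n) #fixed ⟩
      + n                            ∎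
      where
      ring : ∀ n F → + 1 * (n - F) + F ≡ n
      ring = solve-∀

    adjacentSum-2 : adjacentSum 2 ≡ (+ n - #fixed) - N * #fixed
    adjacentSum-2 = begin
      adjacentSum 2
        ≡⟨ adjacentSum-alternating 2 ⟩
      - + 1 * T 3 + T 2
        ≡⟨ cong₂ (λ t₃ t₂ → - + 1 * t₃ + t₂) (twistedCount-suc-suc-suc 0) twistedCount-2 ⟩
      - + 1 * (N * T 1) + (+ n - #fixed)
        ≡⟨ cong (λ t → - + 1 * (N * t) + (+ n - #fixed)) twistedCount-1 ⟩
      - + 1 * (N * #fixed) + (+ n - #fixed)
        ≡⟨ ring (N * #fixed) (+ n - #fixed) ⟩
      (+ n - #fixed) - N * #fixed
        ∎
      where
      ring : ∀ a b → - + 1 * a + b ≡ b - a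
      ring = solve-∀

    adjacentSum-suc-suc-suc : ∀ j → adjacentSum (3 ℕ.+ j) ≡ N * adjacentSum (1 ℕ.+ j)
    adjacentSum-suc-suc-suc j = begin
      adjacentSum (3 ℕ.+ j)
        ≡⟨ adjacentSum-alternating (3 ℕ.+ j) ⟩
      alt (4 ℕ.+ j) * T (4 ℕ.+ j) + T (3 ℕ.+ j)
        ≡⟨ cong₂ (λ a t → a * t + T (3 ℕ.+ j))
                 (ℤ.neg-involutive (alt (2 ℕ.+ j))) (twistedCount-suc-suc-suc (suc j)) ⟩
      alt (2 ℕ.+ j) * (N * T (2 ℕ.+ j)) + T (3 ℕ.+ j)
        ≡⟨ cong (_+_ (alt (2 ℕ.+ j) * (N * T (2 ℕ.+ j)))) (twistedCount-suc-suc-suc j) ⟩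
      alt (2 ℕ.+ j) * (N * T (2 ℕ.+ j)) + N * T (1 ℕ.+ j)
        ≡⟨ ring N (alt (2 ℕ.+ j)) (T (2 ℕ.+ j)) (T (1 ℕ.+ j)) ⟩
      N * (alt (2 ℕ.+ j) * T (2 ℕ.+ j) + T (1 ℕ.+ j))
        ≡⟨ cong (N *_) (adjacentSum-alternating (suc j)) ⟨
      N * adjacentSum (1 ℕ.+ j)
        ∎
      where
      ring : ∀ N a t₂ t₁ → a * (N * t₂) + N * t₁ ≡ N * (a * t₂ + t₁)
      ring = solve-∀

    L-rational : poly (+ 1 ∷ + 1 ∷ - N ∷ - N ∷ []) ⊛ L
                   ≗ₚ poly (+ 1 ∷ - (#fixed - + 1) ∷ + 1 ∷ - (#fixed - + 1) ∷ [])
    L-rational k = trans (poly-⊛ (+ 1 ∷ + 1 ∷ - N ∷ - N ∷ []) L k) (coefficient k)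
      where
      F = #fixed
      y = adjacentSum

      regroup₃ : ∀ N a b c → + 1 * a + (+ 1 * b + - N * c) ≡ (a + b) - N * c
      regroup₃ = solve-∀

      regroup₄ : ∀ N a b c d → + 1 * a + (+ 1 * b + (- N * c + - N * d)) ≡ (a + b) - N * (c + d)
      regroup₄ = solve-∀

      coefficient : ∀ k → ((+ 1 ∷ + 1 ∷ - N ∷ - N ∷ []) ⊙ L) k
                        ≡ poly (+ 1 ∷ - (F - + 1) ∷ + 1 ∷ - (F - + 1) ∷ []) k
      coefficient 0 = cong (+ 1 *_) Lser-0
      coefficient 1 = begin
        + 1 * L 1 + + 1 * L 0  ≡⟨ cong₂ _+_ (ℤ.*-identityˡ (L 1)) (ℤ.*-identityˡ (L 0)) ⟩
        y 0                    ≡⟨ adjacentSum-0 ⟩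
        + 1 - F                ≡⟨ ring F ⟩
        - (F - + 1)            ∎
        where
        ring : ∀ F → + 1 - F ≡ - (F - + 1)
        ring = solve-∀
      coefficient 2 = begin
        + 1 * L 2 + (+ 1 * L 1 + - N * L 0)  ≡⟨ regroup₃ N (L 2) (L 1) (L 0) ⟩
        y 1 - N * L 0                       ≡⟨ cong₂ (λ a b → a - N * b) adjacentSum-1 Lser-0 ⟩
        + n - N * + 1                       ≡⟨ ring (+ n) ⟩
        + 1                                 ∎
        where
        ring : ∀ n → n - (n - + 1) * + 1 ≡ + 1
        ring = solve-∀
      coefficient 3 = begin
        + 1 * L 3 + (+ 1 * L 2 + (- N * L 1 + - N * L 0))
          ≡⟨ regroup₄ N (L 3) (L 2) (L 1) (L 0) ⟩
        y 2 - N * y 0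
          ≡⟨ cong₂ (λ a b → a - N * b) adjacentSum-2 adjacentSum-0 ⟩
        ((+ n - F) - N * F) - N * (+ 1 - F)
          ≡⟨ ring (+ n) F ⟩
        - (F - + 1)
          ∎
        where
        ring : ∀ n F → ((n - F) - (n - + 1) * F) - (n - + 1) * (+ 1 - F) ≡ - (F - + 1)
        ring = solve-∀
      coefficient (suc (suc (suc (suc j)))) = begin
        + 1 * L (4 ℕ.+ j) + (+ 1 * L (3 ℕ.+ j) + (- N * L (2 ℕ.+ j) + - N * L (1 ℕ.+ j)))
          ≡⟨ regroup₄ N (L (4 ℕ.+ j)) (L (3 ℕ.+ j)) (L (2 ℕ.+ j)) (L (1 ℕ.+ j)) ⟩
        y (3 ℕ.+ j) - N * y (1 ℕ.+ j)
          ≡⟨ cong (_- N * y (1 ℕ.+ j)) (adjacentSum-suc-suc-suc j) ⟩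
        N * y (1 ℕ.+ j) - N * y (1 ℕ.+ j)
          ≡⟨ ℤ.+-inverseʳ (N * y (1 ℕ.+ j)) ⟩
        + 0
          ∎

proposition2p1 : (n : ℕ) (σ : Fin n → Fin n) → (∀ i → σ (σ i) ≡ i) →
    (f : ℕ) → f ≡ fixedCount σ →
    (ℓ' : Word n → ℕ) → IsLengthPrime σ ℓ' →
      ((poly (+ 1 ∷ + 1 ∷ []) ⊛ poly (+ 1 ∷ + 0 ∷ - (+ n - + 1) ∷ [])) ⊛ Lser σ ℓ'
         ≗ₚ poly (+ 1 ∷ + 0 ∷ + 1 ∷ []) ⊛ poly (+ 1 ∷ - (+ f - + 1) ∷ []))
    × (poly (+ 1 ∷ - (+ n - + 1) ∷ []) ⊛ Pser n ≗ₚ poly (+ 1 ∷ + 1 ∷ []))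
    × (poly (+ 1 ∷ - (+ f - + 1) ∷ []) ⊛ Fser σ ≗ₚ poly (+ 1 ∷ + 1 ∷ []))
proposition2p1 n σ σ-involutive f refl ℓ' isLengthPrime = L-part , P-rational n , F-rational σ
  where
  open TwistedInvolutions σ σ-involutive
  N = + n - + 1
  d = - (+ f - + 1)
  L-part : (poly (+ 1 ∷ + 1 ∷ []) ⊛ poly (+ 1 ∷ + 0 ∷ - N ∷ [])) ⊛ Lser σ ℓ'
             ≗ₚ poly (+ 1 ∷ + 0 ∷ + 1 ∷ []) ⊛ poly (+ 1 ∷ d ∷ [])
  L-part k = begin
    ((poly (+ 1 ∷ + 1 ∷ []) ⊛ poly (+ 1 ∷ + 0 ∷ - N ∷ [])) ⊛ Lser σ ℓ') k
      ≡⟨ ⊛-congˡ (Lser σ ℓ') ([1+q]⊛[1-cq²] N) k ⟩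
    (poly (+ 1 ∷ + 1 ∷ - N ∷ - N ∷ []) ⊛ Lser σ ℓ') k
      ≡⟨ L-rational isLengthPrime k ⟩
    poly (+ 1 ∷ - (#fixed - + 1) ∷ + 1 ∷ - (#fixed - + 1) ∷ []) k
      ≡⟨ cong (λ F → poly (+ 1 ∷ - (F - + 1) ∷ + 1 ∷ - (F - + 1) ∷ []) k) (fixedCount-∑ σ) ⟨
    poly (+ 1 ∷ d ∷ + 1 ∷ d ∷ []) k
      ≡⟨ [1+q²]⊛[1+dq] d k ⟨
    (poly (+ 1 ∷ + 0 ∷ + 1 ∷ []) ⊛ poly (+ 1 ∷ d ∷ [])) k
      ∎
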